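{- Let $\beta\in\mathfrak S_n$ and $k\in[0,n]$. The set $\{\tau_M(\beta)(i): i\in[0,k]\}$ is the integer interval $[d,d+k]$, where $d$ is the number of descents of $\beta$ greater than $k$.
   Context: A descent of $\beta\in\mathfrak S_n$ is a position $i\in[1,n-1]$ with $\beta(i)>\beta(i+1)$; the rises of $\beta$ are the elements of $\{0,\ldots,n\}$ that are not descents; both are numbered from left to right. $\tau_M(\beta)$ is the permutation of $\{0,\ldots,n\}$ with $\tau_M(\beta)(i)=\operatorname{des}(\beta)-j$ if $i$ is the $j$-th descent of $\beta$ and $\tau_M(\beta)(i)=\operatorname{des}(\beta)+j-1$ if $i$ is the $j$-th rise, where $\operatorname{des}(\beta)$ is the number of descents. -}

module Defs where

open import Data.Nat using (ℕ; zero; suc; _+_; _∸_; _≤_; _<_; _<?_; _≤?_)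
open import Data.Fin using (Fin; toℕ; fromℕ<)
open import Data.Fin.Permutation using (Permutation′; _⟨$⟩ʳ_)
open import Data.Bool using (Bool; true; false; if_then_else_)
open import Data.Product using (_×_)
open import Relation.Nullary using (Dec; yes; no; ¬_)
open import Relation.Nullary.Decidable using (_×-dec_; ⌊_⌋)

-- A permutation β ∈ 𝔖_n is a bijection of Fin n; position p ∈ [1,n]
-- (1-based, as in the paper) corresponds to the Fin-index p - 1.
-- value β p  =  β(p) ∈ [1,n] for 1 ≤ p ≤ n  (and 0 outside, never used).
value : ∀ {n} → Permutation′ n → ℕ → ℕ
value {n} β zero = 0
value {n} β (suc p) with p <? n
... | yes p<n = suc (toℕ (β ⟨$⟩ʳ fromℕ< p<n))
... | no _ = 0

IsDescent : ∀ {n} → Permutation′ n → ℕ → Set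
IsDescent {n} β i = (1 ≤ i) × (i < n) × (value β (suc i) < value β i)

isDescent? : ∀ {n} (β : Permutation′ n) (i : ℕ) → Dec (IsDescent β i)
isDescent? {n} β i = (1 ≤? i) ×-dec ((suc i ≤? n) ×-dec (suc (value β (suc i)) ≤? value β i))

desUpTo : ∀ {n} → Permutation′ n → ℕ → ℕ
desUpTo β zero = 0
desUpTo β (suc i) = if ⌊ isDescent? β (suc i) ⌋ then suc (desUpTo β i) else desUpTo β i

-- number of rises of β in [0, i]  (rises = non-descents in {0,…,n})
risesUpTo : ∀ {n} → Permutation′ n → ℕ → ℕ
risesUpTo β i = suc i ∸ desUpTo β i

des : ∀ {n} → Permutation′ n → ℕ
des {n} β = desUpTo β n

-- τ_M(β) as a function on {0,…,n}:
--   i the j-th descent  ↦ des(β) - j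
--   i the j-th rise     ↦ des(β) + j - 1
τM : ∀ {n} → Permutation′ n → ℕ → ℕ
τM β i with isDescent? β i
... | yes _ = des β ∸ desUpTo β i
... | no _ = des β + risesUpTo β i ∸ 1

desAbove : ∀ {n} → Permutation′ n → ℕ → ℕ
desAbove β k = des β ∸ desUpTo β k

module Submission where

-- The number of descents
-- in [0,i] and the number of rises in [1,i] both grow in unit steps with i, so
-- each takes every value between its extremes, always at a descent,
-- respectively at a rise.  Hence τ_M sends the descents in [0,k] onto
-- [des − desUpTo k, des − 1] and the rises in [0,k] onto
-- [des, des + (k − desUpTo k)]; these two intervals together form [d, d + k].

open import Defs
open import Data.Nat using (ℕ; zero; suc; _+_; _∸_; _≤_; _<_; _<?_; _≤?_; z≤n; s≤s)
open import Data.Nat.Properties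
open import Data.Fin.Permutation using (Permutation′)
open import Data.Product using (_×_; _,_; ∃-syntax)
open import Data.Sum using (_⊎_; inj₁; inj₂)
open import Function.Bundles using (_⇔_; mk⇔)
open import Relation.Nullary using (¬_; Dec; yes; no; contradiction)
open import Relation.Binary.PropositionalEquality using (_≡_; refl; sym; trans; cong; subst; module ≡-Reasoning)

private
  variable
    i j k m t : ℕ

UnitSteps : (ℕ → ℕ) → Set
UnitSteps f = ∀ i → f (suc i) ≡ f i ⊎ f (suc i) ≡ suc (f i)

module _ {f : ℕ → ℕ} (steps : UnitSteps f) where

  unitSteps-≤-suc : ∀ i → f i ≤ f (suc i)
  unitSteps-≤-suc i with steps i
  ... | inj₁ same = ≤-reflexive (sym same)
  ... | inj₂ jump = ≤-trans (n≤1+n (f i)) (≤-reflexive (sym jump))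

  unitSteps-mono : i ≤ j → f i ≤ f j
  unitSteps-mono {j = zero} z≤n = ≤-refl
  unitSteps-mono {j = suc j} i≤1+j with m≤n⇒m<n∨m≡n i≤1+j
  ... | inj₁ (s≤s i≤j) = ≤-trans (unitSteps-mono i≤j) (unitSteps-≤-suc j)
  ... | inj₂ refl = ≤-refl

  unitSteps-≤-+ : ∀ i → f i ≤ f 0 + i
  unitSteps-≤-+ zero = ≤-reflexive (sym (+-identityʳ (f 0)))
  unitSteps-≤-+ (suc i) with steps i
  ... | inj₁ same = ≤-trans (≤-reflexive same)
                      (≤-trans (unitSteps-≤-+ i) (+-monoʳ-≤ (f 0) (n≤1+n i)))
  ... | inj₂ jump = ≤-trans (≤-reflexive jump)
                      (≤-trans (s≤s (unitSteps-≤-+ i)) (≤-reflexive (sym (+-suc (f 0) i))))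

  unitSteps-jumpsTo : ∀ k → f 0 < t → t ≤ f k →
                      ∃[ j ] (suc j ≤ k × f (suc j) ≡ suc (f j) × f (suc j) ≡ t)
  unitSteps-jumpsTo zero f0<t t≤f0 = contradiction t≤f0 (<⇒≱ f0<t)
  unitSteps-jumpsTo {t} (suc k) f0<t t≤f[1+k] with t ≤? f k
  ... | yes t≤fk =
    let (j , j<k , jump , fj≡t) = unitSteps-jumpsTo k f0<t t≤fk
    in j , m≤n⇒m≤1+n j<k , jump , fj≡t
  ... | no t≰fk with steps k
  ...   | inj₁ same = contradiction (subst (t ≤_) same t≤f[1+k]) t≰fk
  ...   | inj₂ jump =
    k , ≤-refl , jump , ≤-antisym (≤-trans (≤-reflexive jump) (≰⇒> t≰fk)) t≤f[1+k]

module _ {n : ℕ} (β : Permutation′ n) where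

  zero-notDescent : ¬ IsDescent β 0
  zero-notDescent (() , _)

  desUpTo-descent : IsDescent β (suc i) → desUpTo β (suc i) ≡ suc (desUpTo β i)
  desUpTo-descent {i} descent with isDescent? β (suc i)
  ... | yes _ = refl
  ... | no rise = contradiction descent rise

  desUpTo-unitSteps : UnitSteps (desUpTo β)
  desUpTo-unitSteps i with isDescent? β (suc i)
  ... | yes _ = inj₂ refl
  ... | no _ = inj₁ refl

  desUpTo-≤ : ∀ i → desUpTo β i ≤ i
  desUpTo-≤ = unitSteps-≤-+ desUpTo-unitSteps

  desUpTo-jump⇒descent : desUpTo β (suc i) ≡ suc (desUpTo β i) → IsDescent β (suc i)
  desUpTo-jump⇒descent {i} jump with isDescent? β (suc i)
  ... | yes descent = descent
  ... | no _ = contradiction (sym jump) 1+n≢n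

  desUpTo-attained : 1 ≤ t → t ≤ desUpTo β k →
                     ∃[ i ] (i ≤ k × IsDescent β i × desUpTo β i ≡ t)
  desUpTo-attained {k = k} 1≤t t≤D =
    let (j , j<k , jump , Dj≡t) = unitSteps-jumpsTo desUpTo-unitSteps k 1≤t t≤D
    in suc j , j<k , desUpTo-jump⇒descent jump , Dj≡t

  -- The rises in [1,i]; since 0 is always a rise, this is risesUpTo β i ∸ 1.
  positiveRisesUpTo : ℕ → ℕ
  positiveRisesUpTo i = i ∸ desUpTo β i

  positiveRisesUpTo-unitSteps : UnitSteps positiveRisesUpTo
  positiveRisesUpTo-unitSteps i with desUpTo-unitSteps i
  ... | inj₁ same = inj₂ (trans (cong (suc i ∸_) same) (+-∸-assoc 1 (desUpTo-≤ i)))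
  ... | inj₂ jump = inj₁ (cong (suc i ∸_) jump)

  positiveRisesUpTo-jump⇒rise : positiveRisesUpTo (suc i) ≡ suc (positiveRisesUpTo i) →
                                ¬ IsDescent β (suc i)
  positiveRisesUpTo-jump⇒rise {i} jump descent
    rewrite desUpTo-descent descent = 1+n≢n (sym jump)

  positiveRisesUpTo-attained : t ≤ positiveRisesUpTo k →
                               ∃[ i ] (i ≤ k × ¬ IsDescent β i × positiveRisesUpTo i ≡ t)
  positiveRisesUpTo-attained {zero} _ = 0 , z≤n , zero-notDescent , refl
  positiveRisesUpTo-attained {suc t} {k} t≤R =
    let (j , j<k , jump , Rj≡t) =
          unitSteps-jumpsTo positiveRisesUpTo-unitSteps k (s≤s z≤n) t≤R
    in suc j , j<k , positiveRisesUpTo-jump⇒rise jump , Rj≡t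

  τM-descent : IsDescent β i → τM β i ≡ des β ∸ desUpTo β i
  τM-descent {i} descent with isDescent? β i
  ... | yes _ = refl
  ... | no rise = contradiction descent rise

  τM-rise : ¬ IsDescent β i → τM β i ≡ des β + positiveRisesUpTo i
  τM-rise {i} rise with isDescent? β i
  ... | yes descent = contradiction descent rise
  ... | no _ = begin
    des β + (suc i ∸ desUpTo β i) ∸ 1     ≡⟨ cong (λ r → des β + r ∸ 1) (+-∸-assoc 1 (desUpTo-≤ i)) ⟩
    des β + suc (positiveRisesUpTo i) ∸ 1 ≡⟨ cong (_∸ 1) (+-suc (des β) (positiveRisesUpTo i)) ⟩
    des β + positiveRisesUpTo i           ∎
    where open ≡-Reasoning

  module _ (k≤n : k ≤ n) where

    desUpTo-≤-des : desUpTo β k ≤ des β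
    desUpTo-≤-des = unitSteps-mono desUpTo-unitSteps k≤n

    desAbove+k≡des+positiveRisesUpTo : desAbove β k + k ≡ des β + positiveRisesUpTo k
    desAbove+k≡des+positiveRisesUpTo = begin
      (des β ∸ desUpTo β k) + k   ≡⟨ sym (+-∸-comm k desUpTo-≤-des) ⟩
      (des β + k) ∸ desUpTo β k   ≡⟨ +-∸-assoc (des β) (desUpTo-≤ k) ⟩
      des β + positiveRisesUpTo k ∎
      where open ≡-Reasoning

    des-≤-desAbove+k : des β ≤ desAbove β k + k
    des-≤-desAbove+k = ≤-trans (m≤m+n (des β) (positiveRisesUpTo k))
                               (≤-reflexive (sym desAbove+k≡des+positiveRisesUpTo))

    τM-bounds : i ≤ k → desAbove β k ≤ τM β i × τM β i ≤ desAbove β k + k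
    τM-bounds {i} i≤k = bounds (isDescent? β i)
      where
      bounds : Dec (IsDescent β i) → desAbove β k ≤ τM β i × τM β i ≤ desAbove β k + k
      bounds (yes descent) rewrite τM-descent descent =
          ∸-monoʳ-≤ (des β) (unitSteps-mono desUpTo-unitSteps i≤k)
        , ≤-trans (m∸n≤m (des β) (desUpTo β i)) des-≤-desAbove+k
      bounds (no rise) rewrite τM-rise rise =
          ≤-trans (m∸n≤m (des β) (desUpTo β k)) (m≤m+n (des β) (positiveRisesUpTo i))
        , ≤-trans (+-monoʳ-≤ (des β) (unitSteps-mono positiveRisesUpTo-unitSteps i≤k))
                  (≤-reflexive (sym desAbove+k≡des+positiveRisesUpTo))

    τM-descents-onto : desAbove β k ≤ m → m < des β → ∃[ i ] (i ≤ k × τM β i ≡ m)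
    τM-descents-onto {m} d≤m m<des =
      let t≤D = ≤-trans (∸-monoʳ-≤ (des β) d≤m) (≤-reflexive (m∸[m∸n]≡n desUpTo-≤-des))
          (i , i≤k , descent , Di≡t) = desUpTo-attained (m<n⇒0<n∸m m<des) t≤D
      in i , i≤k , (begin
        τM β i                 ≡⟨ τM-descent descent ⟩
        des β ∸ desUpTo β i    ≡⟨ cong (des β ∸_) Di≡t ⟩
        des β ∸ (des β ∸ m)    ≡⟨ m∸[m∸n]≡n (<⇒≤ m<des) ⟩
        m                      ∎)
      where open ≡-Reasoning

    τM-rises-onto : des β ≤ m → m ≤ desAbove β k + k → ∃[ i ] (i ≤ k × τM β i ≡ m)
    τM-rises-onto {m} des≤m m≤d+k =
      let r≤R = ≤-trans (∸-monoˡ-≤ (des β) (≤-trans m≤d+k (≤-reflexive desAbove+k≡des+positiveRisesUpTo)))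
                        (≤-reflexive (m+n∸m≡n (des β) (positiveRisesUpTo k)))
          (i , i≤k , rise , Ri≡r) = positiveRisesUpTo-attained r≤R
      in i , i≤k , (begin
        τM β i                      ≡⟨ τM-rise rise ⟩
        des β + positiveRisesUpTo i ≡⟨ cong (des β +_) Ri≡r ⟩
        des β + (m ∸ des β)         ≡⟨ m+[n∸m]≡n des≤m ⟩
        m                           ∎)
      where open ≡-Reasoning

mainTheorem12 : ∀ (n : ℕ) (β : Permutation′ n) (k : ℕ) → k ≤ n →
    ∀ (m : ℕ) →
      (∃[ i ] (i ≤ k × τM β i ≡ m)) ⇔ (desAbove β k ≤ m × m ≤ desAbove β k + k)
mainTheorem12 n β k k≤n m = mk⇔ inImage⇒inInterval inInterval⇒inImage
  where
  inImage⇒inInterval : ∃[ i ] (i ≤ k × τM β i ≡ m) → desAbove β k ≤ m × m ≤ desAbove β k + k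
  inImage⇒inInterval (i , i≤k , refl) = τM-bounds β k≤n i≤k

  inInterval⇒inImage : desAbove β k ≤ m × m ≤ desAbove β k + k → ∃[ i ] (i ≤ k × τM β i ≡ m)
  inInterval⇒inImage (d≤m , m≤d+k) with m <? des β
  ... | yes m<des = τM-descents-onto β k≤n d≤m m<des
  ... | no m≮des = τM-rises-onto β k≤n (≮⇒≥ m≮des) m≤d+k
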